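{- Every Baxter permutation $w$ has the same number of descents as inverse descents, i.e. the number of descents of $w$ equals the number of descents of $w^{ -1}$.
   Context: A permutation $w=w_1\ldots w_n$ is a Baxter permutation if there are no indices $i<j<j+1<k$ with $w_j<w_k<w_i<w_{j+1}$ (pattern 3-14-2) and no indices $i<j<j+1<k$ with $w_{j+1}<w_i<w_k<w_j$ (pattern 2-41-3). A descent of $w$ is an index $i$ with $w_i>w_{i+1}$; an inverse descent of $w$ is a descent of $w^{ -1}$, i.e. an $i$ such that $i+1$ appears to the left of $i$ in $w$. -}

module Defs where

open import Data.Nat using (ℕ; zero; suc; _+_; _<ᵇ_; _<_)
open import Data.Bool using (if_then_else_)
open import Data.Fin using (Fin; toℕ)
open import Data.Fin.Permutation using (Permutation′; _⟨$⟩ʳ_; _⟨$⟩ˡ_)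
open import Data.List using (List; []; _∷_; map; allFin)
open import Data.Product using (_×_)
open import Relation.Nullary using (¬_)
open import Relation.Binary.PropositionalEquality using (_≡_)

-- Conventions: positions and values are 0-indexed (Fin n), which does
-- not affect the statement.  A permutation w : Permutation′ n is the word
-- w(0) w(1) ... w(n-1); its inverse is given by _⟨$⟩ˡ_.

descentsList : List ℕ → ℕ
descentsList []            = 0
descentsList (x ∷ [])      = 0
descentsList (x ∷ y ∷ xs)  = (if y <ᵇ x then 1 else 0) + descentsList (y ∷ xs)

word : {n : ℕ} → (Fin n → Fin n) → List ℕ
word {n} f = map (λ i → toℕ (f i)) (allFin n)

des : {n : ℕ} → Permutation′ n → ℕ
des w = descentsList (word (w ⟨$⟩ʳ_))

ides : {n : ℕ} → Permutation′ n → ℕ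
ides w = descentsList (word (w ⟨$⟩ˡ_))

-- Baxter permutations: no i < j < j+1 < k with
--   w_j < w_k < w_i < w_{j+1}   (pattern 3-14-2)  and no
--   w_{j+1} < w_i < w_k < w_j   (pattern 2-41-3).
IsBaxter : {n : ℕ} → Permutation′ n → Set
IsBaxter {n} w =
  (i j j' k : Fin n) → toℕ i < toℕ j → toℕ j' ≡ suc (toℕ j) → toℕ j' < toℕ k →
    ¬ (toℕ (w ⟨$⟩ʳ j) < toℕ (w ⟨$⟩ʳ k) × toℕ (w ⟨$⟩ʳ k) < toℕ (w ⟨$⟩ʳ i)
         × toℕ (w ⟨$⟩ʳ i) < toℕ (w ⟨$⟩ʳ j'))
    × ¬ (toℕ (w ⟨$⟩ʳ j') < toℕ (w ⟨$⟩ʳ i) × toℕ (w ⟨$⟩ʳ i) < toℕ (w ⟨$⟩ʳ k)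
         × toℕ (w ⟨$⟩ʳ k) < toℕ (w ⟨$⟩ʳ j))

-- Say that a descent j of w (w(j+1) < w(j)) and a descent v of w⁻¹ (v+1 standing
-- left of v in w) cross when w(j+1) ≤ v < w(j) and pos(v+1) ≤ j < pos(v).  As the
-- value runs from w(j+1) up to w(j), its position moves from j+1 to j.  In a Baxter
-- permutation it can never jump from the left of the gap between j and j+1 to the
-- right of it (that jump would be a 2-41-3), so it jumps from right to left exactly
-- once: every descent of w crosses exactly one descent of w⁻¹.  Symmetrically, using
-- 3-14-2, every descent of w⁻¹ crosses exactly one descent of w, so counting the
-- crossing pairs in both ways gives des(w) = des(w⁻¹).
module Submission where

open import Defs
open import Data.Bool using (Bool; true; false; T; not; _∧_; if_then_else_)
open import Data.Bool.Properties using (∧-assoc; ∧-comm; T-≡)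
open import Data.Empty using (⊥; ⊥-elim)
open import Data.Fin as Fin using (Fin; toℕ; fromℕ<)
open import Data.Fin.Properties using (toℕ<n; toℕ-fromℕ<)
open import Data.Fin.Permutation using (Permutation′; _⟨$⟩ʳ_; _⟨$⟩ˡ_; inverseˡ; flip)
open import Data.List using (tabulate)
open import Data.List.Properties using (map-tabulate)
open import Data.Nat using (ℕ; zero; suc; pred; _+_; _∸_; _<ᵇ_; _<_; _≤_; s≤s; s≤s⁻¹; z<s; s<s)
open import Data.Nat.Properties
open import Algebra.Properties.CommutativeMonoid.Sum +-0-commutativeMonoid
  using (sum; sum-cong-≗; sum-replicate-zero; ∑-comm)
open import Data.Product using (_×_; _,_; proj₁; proj₂)
open import Function using (_∘_; id)
open import Function.Bundles using (Equivalence)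
open import Relation.Nullary using (¬_; contradiction)
open import Relation.Nullary.Reflects using (ofʸ; ofⁿ)
open import Relation.Binary.PropositionalEquality

⟦_⟧ : Bool → ℕ
⟦ b ⟧ = if b then 1 else 0

∑< : ℕ → (ℕ → ℕ) → ℕ
∑< k h = sum {k} (h ∘ toℕ)

count : (ℕ → Bool) → ℕ → ℕ
count P k = ∑< k (λ t → ⟦ P t ⟧)

∑<-cong : ∀ k {h h′ : ℕ → ℕ} → (∀ t → t < k → h t ≡ h′ t) → ∑< k h ≡ ∑< k h′
∑<-cong k h≗h′ = sum-cong-≗ (λ i → h≗h′ (toℕ i) (toℕ<n i))

∑<-comm : ∀ m k (h : ℕ → ℕ → ℕ) →
          ∑< m (λ i → ∑< k (h i)) ≡ ∑< k (λ j → ∑< m (λ i → h i j))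
∑<-comm m k h = ∑-comm {m} {k} (λ i j → h (toℕ i) (toℕ j))

count-cong : ∀ k {P Q : ℕ → Bool} → (∀ t → P t ≡ Q t) → count P k ≡ count Q k
count-cong k P≗Q = ∑<-cong k (λ t _ → cong ⟦_⟧ (P≗Q t))

count-below : ∀ b N (P : ℕ → Bool) → b ≤ N →
              count (λ v → (v <ᵇ b) ∧ P v) N ≡ count P b
count-below zero    N       P _         = sum-replicate-zero N
count-below (suc b) (suc N) P (s≤s b≤N) = cong (⟦ P 0 ⟧ +_) (count-below b N (P ∘ suc) b≤N)

count-from : ∀ a b (P : ℕ → Bool) →
             count (λ v → (a <ᵇ suc v) ∧ P v) b ≡ count (λ t → P (a + t)) (b ∸ a)
count-from zero    b       P = refl
count-from (suc a) zero    P = refl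
count-from (suc a) (suc b) P = count-from a b (P ∘ suc)

count-window : ∀ a b N (P : ℕ → Bool) → b ≤ N →
               count (λ v → ((v <ᵇ b) ∧ (a <ᵇ suc v)) ∧ P v) N ≡
               count (λ t → P (a + t)) (b ∸ a)
count-window a b N P b≤N = begin
  count (λ v → ((v <ᵇ b) ∧ (a <ᵇ suc v)) ∧ P v) N
    ≡⟨ count-cong N (λ v → ∧-assoc (v <ᵇ b) (a <ᵇ suc v) (P v)) ⟩
  count (λ v → (v <ᵇ b) ∧ ((a <ᵇ suc v) ∧ P v)) N
    ≡⟨ count-below b N (λ v → (a <ᵇ suc v) ∧ P v) b≤N ⟩
  count (λ v → (a <ᵇ suc v) ∧ P v) b
    ≡⟨ count-from a b P ⟩
  count (λ t → P (a + t)) (b ∸ a)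
    ∎
  where open ≡-Reasoning

rise : (ℕ → Bool) → ℕ → Bool
rise Q t = not (Q t) ∧ Q (suc t)

count-rises : ∀ (Q : ℕ → Bool) k → (∀ t → t < k → T (Q t) → T (Q (suc t))) →
              ⟦ Q 0 ⟧ + count (rise Q) k ≡ ⟦ Q k ⟧
count-rises Q zero    _    = +-identityʳ ⟦ Q 0 ⟧
count-rises Q (suc k) mono = begin
  ⟦ Q 0 ⟧ + (⟦ rise Q 0 ⟧ + rises)  ≡⟨ +-assoc ⟦ Q 0 ⟧ _ _ ⟨
  (⟦ Q 0 ⟧ + ⟦ rise Q 0 ⟧) + rises  ≡⟨ cong (_+ rises) (first-rise (Q 0) (Q 1) (mono 0 z<s)) ⟩
  ⟦ Q 1 ⟧ + rises                   ≡⟨ count-rises (Q ∘ suc) k (λ t t<k → mono (suc t) (s<s t<k)) ⟩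
  ⟦ Q (suc k) ⟧                     ∎
  where
  open ≡-Reasoning
  rises = count (rise (Q ∘ suc)) k
  first-rise : ∀ x y → (T x → T y) → ⟦ x ⟧ + ⟦ not x ∧ y ⟧ ≡ ⟦ y ⟧
  first-rise false y     _   = refl
  first-rise true  true  _   = refl
  first-rise true  false x⇒y = ⊥-elim (x⇒y _)

<ᵇ-true : ∀ {m n} → m < n → (m <ᵇ n) ≡ true
<ᵇ-true = Equivalence.to T-≡ ∘ <⇒<ᵇ

<ᵇ-false : ∀ {m n} → n ≤ m → (m <ᵇ n) ≡ false
<ᵇ-false {m} {n} n≤m with m <ᵇ n | <ᵇ-reflects-< m n
... | false | _        = refl
... | true  | ofʸ m<n = contradiction n≤m (<⇒≱ m<n)

m<ᵇn≡not[n<ᵇ1+m] : ∀ m n → (m <ᵇ n) ≡ not (n <ᵇ suc m)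
m<ᵇn≡not[n<ᵇ1+m] zero    zero    = refl
m<ᵇn≡not[n<ᵇ1+m] zero    (suc n) = refl
m<ᵇn≡not[n<ᵇ1+m] (suc m) zero    = refl
m<ᵇn≡not[n<ᵇ1+m] (suc m) (suc n) = m<ᵇn≡not[n<ᵇ1+m] m n

<pred⇒suc< : ∀ {j n} → j < pred n → suc j < n
<pred⇒suc< {n = suc n} j<n = s<s j<n

Descent : (ℕ → ℕ) → ℕ → Bool
Descent f j = f (suc j) <ᵇ f j

InGap : (ℕ → ℕ) → ℕ → ℕ → Bool
InGap f j v = (v <ᵇ f j) ∧ (f (suc j) <ᵇ suc v)

record InversePair (n : ℕ) : Set where
  field
    f f⁻¹ : ℕ → ℕ
    f<n   : ∀ {i} → i < n → f i < n
    f⁻¹<n : ∀ {i} → i < n → f⁻¹ i < n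
    f⁻¹∘f : ∀ {i} → i < n → f⁻¹ (f i) ≡ i
    f∘f⁻¹ : ∀ {i} → i < n → f (f⁻¹ i) ≡ i

inverse : ∀ {n} → InversePair n → InversePair n
inverse P = record
  { f = f⁻¹ ; f⁻¹ = f
  ; f<n = f⁻¹<n ; f⁻¹<n = f<n
  ; f⁻¹∘f = f∘f⁻¹ ; f∘f⁻¹ = f⁻¹∘f
  }
  where open InversePair P

Pattern3142 Pattern2413 : ℕ → ℕ → ℕ → ℕ → Set
Pattern3142 wi wj wj+1 wk = wj < wk × wk < wi × wi < wj+1
Pattern2413 wi wj wj+1 wk = wj+1 < wi × wi < wk × wk < wj

Avoids3142 Avoids2413 : ℕ → (ℕ → ℕ) → Set
Avoids3142 n f = ∀ {i j k} → i < j → suc j < k → k < n →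
                 ¬ Pattern3142 (f i) (f j) (f (suc j)) (f k)
Avoids2413 n f = ∀ {i j k} → i < j → suc j < k → k < n →
                 ¬ Pattern2413 (f i) (f j) (f (suc j)) (f k)

Crossing : ∀ {n} → InversePair n → ℕ → ℕ → Bool
Crossing P j v = InGap f j v ∧ InGap f⁻¹ v j
  where open InversePair P

crossing-inverse : ∀ {n} (P : InversePair n) j v → Crossing P j v ≡ Crossing (inverse P) v j
crossing-inverse P j v = ∧-comm (InGap f j v) _
  where open InversePair P

-- Occurrences of 2-41-3 at positions i < j < j + 1 < k whose entries 2 and 3 are
-- consecutive values v, v + 1, so that i = f⁻¹ v and k = f⁻¹ (v + 1).
NoBivincular2413 : ∀ {n} → InversePair n → Set
NoBivincular2413 {n} P = ∀ {j v} → suc j < n → f (suc j) < v → suc v < f j →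
                         f⁻¹ v < j → suc j < f⁻¹ (suc v) → ⊥
  where open InversePair P

module _ {n} (P : InversePair n) where
  open InversePair P

  avoids2413⇒noBivincular2413 : Avoids2413 n f → NoBivincular2413 P
  avoids2413⇒noBivincular2413 avoid {j} {v} 1+j<n a<v 1+v<b i<j 1+j<k =
    avoid i<j 1+j<k (f⁻¹<n 1+v<n) occurrence
    where
    1+v<n : suc v < n
    1+v<n = <-trans 1+v<b (f<n (<⇒≤ 1+j<n))
    occurrence : Pattern2413 (f (f⁻¹ v)) (f j) (f (suc j)) (f (f⁻¹ (suc v)))
    occurrence rewrite f∘f⁻¹ (<⇒≤ 1+v<n) | f∘f⁻¹ 1+v<n = a<v , n<1+n v , 1+v<b

  avoids3142⇒noBivincular2413⁻¹ : Avoids3142 n f → NoBivincular2413 (inverse P)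
  avoids3142⇒noBivincular2413⁻¹ avoid {j} {v} 1+j<n i<v 1+v<k wv<j 1+j<wv+1 =
    avoid i<v 1+v<k (f⁻¹<n j<n) occurrence
    where
    j<n : j < n
    j<n = <⇒≤ 1+j<n
    occurrence : Pattern3142 (f (f⁻¹ (suc j))) (f v) (f (suc v)) (f (f⁻¹ j))
    occurrence rewrite f∘f⁻¹ 1+j<n | f∘f⁻¹ j<n = wv<j , n<1+n j , 1+j<wv+1

  -- The jump forbidden by NoBivincular2413, with the endpoints of the gap allowed:
  -- these cannot occur, since f (j + 1) and f j sit at positions j + 1 and j.
  no-jump-out-of-gap : NoBivincular2413 P → ∀ {j v} → suc j < n → f (suc j) ≤ v → v < f j →
                       f⁻¹ v ≤ j → j < f⁻¹ (suc v) → ⊥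
  no-jump-out-of-gap no2413 {j} {v} 1+j<n a≤v v<b i≤j j<k =
    no2413 1+j<n a<v 1+v<b i<j 1+j<k
    where
    position-of : ∀ {x y} → x < n → f x ≡ y → f⁻¹ y ≡ x
    position-of x<n refl = f⁻¹∘f x<n
    value-at : ∀ {x y} → x < n → f⁻¹ x ≡ y → f y ≡ x
    value-at x<n refl = f∘f⁻¹ x<n
    j<n = <⇒≤ 1+j<n
    1+v<n = ≤-<-trans v<b (f<n j<n)
    a<v = ≤∧≢⇒< a≤v (λ a≡v → 1+n≰n (subst (_≤ j) (position-of 1+j<n a≡v) i≤j))
    1+v<b = ≤∧≢⇒< v<b (λ 1+v≡b → <-irrefl (sym (position-of j<n (sym 1+v≡b))) j<k)
    i<j = ≤∧≢⇒< i≤j (λ i≡j → <-irrefl (sym (value-at (<⇒≤ 1+v<n) i≡j)) v<b)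
    1+j<k = ≤∧≢⇒< j<k (λ 1+j≡k → 1+n≰n (subst (_≤ v) (value-at 1+v<n (sym 1+j≡k)) a≤v))

  crossings-in-gap : ∀ {j} → suc j < n →
                     count (Crossing P j) (pred n) ≡
                     count (λ t → InGap f⁻¹ (f (suc j) + t) j) (f j ∸ f (suc j))
  crossings-in-gap {j} 1+j<n =
    count-window (f (suc j)) (f j) (pred n) (λ v → InGap f⁻¹ v j) (<⇒≤pred (f<n (<⇒≤ 1+j<n)))

  -- Left t: the value f (j + 1) + t stands at a position ≤ j.  The crossings of j are
  -- the rises of Left, and NoBivincular2413 makes Left monotone, so it rises exactly once.
  count-crossings : NoBivincular2413 P → ∀ {j} → suc j < n →
                    count (Crossing P j) (pred n) ≡ ⟦ Descent f j ⟧
  count-crossings no2413 {j} 1+j<n with Descent f j | <ᵇ-reflects-< (f (suc j)) (f j)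
  ... | false | ofⁿ a≮b = trans (crossings-in-gap 1+j<n)
    (cong (count (λ t → InGap f⁻¹ (f (suc j) + t) j)) (m≤n⇒m∸n≡0 (≮⇒≥ a≮b)))
  ... | true  | ofʸ a<b = begin
    count (Crossing P j) (pred n)              ≡⟨ crossings-in-gap 1+j<n ⟩
    count (λ t → InGap f⁻¹ (a + t) j) (b ∸ a)  ≡⟨ count-cong (b ∸ a) gap≡rise ⟩
    count (rise Left) (b ∸ a)                  ≡⟨ cong (λ x → ⟦ x ⟧ + rises) left-start ⟨
    ⟦ Left 0 ⟧ + rises                         ≡⟨ count-rises Left (b ∸ a) left-monotone ⟩
    ⟦ Left (b ∸ a) ⟧                           ≡⟨ cong ⟦_⟧ left-end ⟩
    1                                          ∎
    where
    open ≡-Reasoning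
    a = f (suc j)
    b = f j
    j<n = <⇒≤ 1+j<n
    Left : ℕ → Bool
    Left t = f⁻¹ (a + t) <ᵇ suc j
    rises = count (rise Left) (b ∸ a)
    gap≡rise : ∀ t → InGap f⁻¹ (a + t) j ≡ rise Left t
    gap≡rise t = cong₂ _∧_ (m<ᵇn≡not[n<ᵇ1+m] j (f⁻¹ (a + t)))
                           (cong (λ x → f⁻¹ x <ᵇ suc j) (sym (+-suc a t)))
    left-start : Left 0 ≡ false
    left-start rewrite +-identityʳ a | f⁻¹∘f 1+j<n = <ᵇ-false {suc j} ≤-refl
    left-end : Left (b ∸ a) ≡ true
    left-end rewrite m+[n∸m]≡n (<⇒≤ a<b) | f⁻¹∘f j<n = <ᵇ-true (n<1+n j)
    left-monotone : ∀ t → t < b ∸ a → T (Left t) → T (Left (suc t))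
    left-monotone t t<b∸a left = <⇒<ᵇ (s≤s (≮⇒≥ λ j<k →
      no-jump-out-of-gap no2413 1+j<n (m≤m+n a t) a+t<b (s≤s⁻¹ (<ᵇ⇒< _ _ left))
        (subst (λ x → j < f⁻¹ x) (+-suc a t) j<k)))
      where
      a+t<b : a + t < b
      a+t<b = subst (a + t <_) (m+[n∸m]≡n (<⇒≤ a<b)) (+-monoʳ-< a t<b∸a)

  descents≡crossings : NoBivincular2413 P →
                       count (Descent f) (pred n) ≡ ∑< (pred n) (λ j → count (Crossing P j) (pred n))
  descents≡crossings no2413 =
    ∑<-cong (pred n) (λ j j<n-1 → sym (count-crossings no2413 (<pred⇒suc< j<n-1)))

descents-balanced : ∀ {n} (P : InversePair n) → NoBivincular2413 P → NoBivincular2413 (inverse P) →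
                    count (Descent (InversePair.f P)) (pred n) ≡
                    count (Descent (InversePair.f⁻¹ P)) (pred n)
descents-balanced {n} P no2413 no2413⁻¹ = begin
  count (Descent f) N
    ≡⟨ descents≡crossings P no2413 ⟩
  ∑< N (λ j → count (Crossing P j) N)
    ≡⟨ ∑<-comm N N (λ j v → ⟦ Crossing P j v ⟧) ⟩
  ∑< N (λ v → ∑< N (λ j → ⟦ Crossing P j v ⟧))
    ≡⟨ ∑<-cong N (λ v _ → count-cong N (λ j → crossing-inverse P j v)) ⟩
  ∑< N (λ v → count (Crossing (inverse P) v) N)
    ≡⟨ descents≡crossings (inverse P) no2413⁻¹ ⟨
  count (Descent f⁻¹) N
    ∎
  where
  open ≡-Reasoning
  open InversePair P
  N = pred n

-- h extended by 0 outside {0, …, n - 1}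
at : ∀ {n} → (Fin n → ℕ) → ℕ → ℕ
at {zero}  h _       = 0
at {suc n} h zero    = h Fin.zero
at {suc n} h (suc i) = at (h ∘ Fin.suc) i

at-toℕ : ∀ {n} (h : Fin n → ℕ) (x : Fin n) → at h (toℕ x) ≡ h x
at-toℕ h Fin.zero    = refl
at-toℕ h (Fin.suc x) = at-toℕ (h ∘ Fin.suc) x

at-fromℕ< : ∀ {n} (h : Fin n → ℕ) {i} (i<n : i < n) → at h i ≡ h (fromℕ< i<n)
at-fromℕ< h i<n = trans (cong (at h) (sym (toℕ-fromℕ< i<n))) (at-toℕ h (fromℕ< i<n))

descentsList-tabulate : ∀ n (h : Fin n → ℕ) →
                        descentsList (tabulate h) ≡ count (Descent (at h)) (pred n)
descentsList-tabulate zero            h = refl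
descentsList-tabulate (suc zero)      h = refl
descentsList-tabulate (suc n@(suc _)) h =
  cong (⟦ h (Fin.suc Fin.zero) <ᵇ h Fin.zero ⟧ +_) (descentsList-tabulate n (h ∘ Fin.suc))

onℕ : ∀ {n} → Permutation′ n → ℕ → ℕ
onℕ w = at (toℕ ∘ (w ⟨$⟩ʳ_))

onℕ-fromℕ< : ∀ {n} (w : Permutation′ n) {i} (i<n : i < n) →
             onℕ w i ≡ toℕ (w ⟨$⟩ʳ fromℕ< i<n)
onℕ-fromℕ< w = at-fromℕ< (toℕ ∘ (w ⟨$⟩ʳ_))

onℕ<n : ∀ {n} (w : Permutation′ n) {i} → i < n → onℕ w i < n
onℕ<n w i<n rewrite onℕ-fromℕ< w i<n = toℕ<n _

onℕ-flip-inverse : ∀ {n} (w : Permutation′ n) {i} → i < n → onℕ (flip w) (onℕ w i) ≡ i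
onℕ-flip-inverse w {i} i<n = begin
  onℕ (flip w) (onℕ w i)                   ≡⟨ cong (onℕ (flip w)) (onℕ-fromℕ< w i<n) ⟩
  onℕ (flip w) (toℕ (w ⟨$⟩ʳ fromℕ< i<n))   ≡⟨ at-toℕ (toℕ ∘ (w ⟨$⟩ˡ_)) _ ⟩
  toℕ (w ⟨$⟩ˡ (w ⟨$⟩ʳ fromℕ< i<n))         ≡⟨ cong toℕ (inverseˡ w) ⟩
  toℕ (fromℕ< i<n)                         ≡⟨ toℕ-fromℕ< i<n ⟩
  i                                        ∎
  where open ≡-Reasoning

permutationPair : ∀ {n} → Permutation′ n → InversePair n
permutationPair w = record
  { f     = onℕ w
  ; f⁻¹   = onℕ (flip w)
  ; f<n   = onℕ<n w
  ; f⁻¹<n = onℕ<n (flip w)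
  ; f⁻¹∘f = onℕ-flip-inverse w
  ; f∘f⁻¹ = onℕ-flip-inverse (flip w)
  }

des≡count-descents : ∀ {n} (w : Permutation′ n) → des w ≡ count (Descent (onℕ w)) (pred n)
des≡count-descents {n} w =
  trans (cong descentsList (map-tabulate id (toℕ ∘ (w ⟨$⟩ʳ_)))) (descentsList-tabulate n _)

isBaxter-onℕ : ∀ {n} (w : Permutation′ n) → IsBaxter w →
               ∀ {i j k} → i < j → suc j < k → k < n →
               ¬ Pattern3142 (onℕ w i) (onℕ w j) (onℕ w (suc j)) (onℕ w k) ×
               ¬ Pattern2413 (onℕ w i) (onℕ w j) (onℕ w (suc j)) (onℕ w k)
isBaxter-onℕ {n} w baxter {i} {j} {k} i<j 1+j<k k<n = occurrence-free
  where
  1+j<n = <-trans 1+j<k k<n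
  j<n = <⇒≤ 1+j<n
  i<n = <-trans i<j j<n
  toℕ-fromℕ<-< : ∀ {x y} (x<n : x < n) (y<n : y < n) → x < y →
                 toℕ (fromℕ< x<n) < toℕ (fromℕ< y<n)
  toℕ-fromℕ<-< x<n y<n = subst₂ _<_ (sym (toℕ-fromℕ< x<n)) (sym (toℕ-fromℕ< y<n))
  occurrence-free : ¬ Pattern3142 (onℕ w i) (onℕ w j) (onℕ w (suc j)) (onℕ w k) ×
                    ¬ Pattern2413 (onℕ w i) (onℕ w j) (onℕ w (suc j)) (onℕ w k)
  occurrence-free
    rewrite onℕ-fromℕ< w i<n | onℕ-fromℕ< w j<n | onℕ-fromℕ< w 1+j<n | onℕ-fromℕ< w k<n =
    baxter (fromℕ< i<n) (fromℕ< j<n) (fromℕ< 1+j<n) (fromℕ< k<n)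
      (toℕ-fromℕ<-< i<n j<n i<j)
      (trans (toℕ-fromℕ< 1+j<n) (cong suc (sym (toℕ-fromℕ< j<n))))
      (toℕ-fromℕ<-< 1+j<n k<n 1+j<k)

corollary3p2 : (n : ℕ) (w : Permutation′ n) → IsBaxter w → des w ≡ ides w
corollary3p2 n w baxter = begin
  des w                                    ≡⟨ des≡count-descents w ⟩
  count (Descent (onℕ w)) (pred n)         ≡⟨ descents-balanced P no2413 no2413⁻¹ ⟩
  count (Descent (onℕ (flip w))) (pred n)  ≡⟨ des≡count-descents (flip w) ⟨
  ides w                                   ∎
  where
  open ≡-Reasoning
  P = permutationPair w
  no2413 = avoids2413⇒noBivincular2413 P
    (λ i<j 1+j<k k<n → proj₂ (isBaxter-onℕ w baxter i<j 1+j<k k<n))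
  no2413⁻¹ = avoids3142⇒noBivincular2413⁻¹ P
    (λ i<j 1+j<k k<n → proj₁ (isBaxter-onℕ w baxter i<j 1+j<k k<n))
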